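{- Let $\beta$ and $\gamma$ be loops in $G_n$ based at the same vertex $v$. If $\gamma$ is totally driftless, then the concatenation $\beta\gamma$ is totally driftless.
   Context: $[n]=\{1,\dots,n\}$. For distinct reals $y_1,\dots,y_n$, $\mathrm{Order}(y_1,\dots,y_n)$ is the unique $\sigma\in S_n$ with $y_i<y_j$ iff $\sigma(i)<\sigma(j)$. $\rho,\rho':S_{n+1}\to S_n$: $\rho(\sigma)=\mathrm{Order}(\sigma(1),\dots,\sigma(n))$, $\rho'(\sigma)=\mathrm{Order}(\sigma(2),\dots,\sigma(n+1))$. The permutation digraph $G_n$ has vertex set $S_n$ and edge set $S_{n+1}$, edge $e$ directed from $\rho(e)$ to $\rho'(e)$. A path of length $\ell$ is $(v_0,e_1,v_1,\dots,e_\ell,v_\ell)$ with $e_i$ directed from $v_{i-1}$ to $v_i$; a loop based at $v_0$ is a finite path of length $\ell\ge1$ with $v_\ell=v_0$. For a path $p$ of length $\ell$ let $Q_p=\{x_1,\dots,x_{\ell+n}\}$ with $\le$ the reflexive-transitive closure of: $x_{a+c}\le x_{a+d}$ when $0\le a\le\ell$, $c,d\in[n]$, $v_a(c)\le v_a(d)$; $x_{a-1+c}\le x_{a-1+d}$ when $1\le a\le\ell$, $c,d\in[n+1]$, $e_a(c)\le e_a(d)$. For a loop $\gamma$ of length $\ell$ and $i,j\in[n]$, $\mathrm{Drift}_\gamma(i,j)=+$ if $x_i\le x_{\ell+j}$ in $Q_\gamma$, $-$ if $x_i\ge x_{\ell+j}$, $0$ if incomparable. $\gamma$ is totally driftless if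 $\mathrm{Drift}_\gamma(i,j)=0$ for all $i,j\in[n]$. -}

module Defs where

open import Data.Nat using (ℕ; zero; suc; _+_; _∸_; _≤?_) renaming (_≤_ to _≤ℕ_)
open import Data.Fin using (Fin; toℕ; inject₁) renaming (suc to fsuc)
import Data.Fin as F
open import Data.Product using (Σ; _×_; _,_; ∃)
open import Data.Sum using (_⊎_)
open import Relation.Binary.PropositionalEquality using (_≡_)
open import Relation.Nullary using (¬_; yes; no)
open import Function.Definitions using (Injective)
open import Relation.Binary.Construct.Closure.ReflexiveTransitive using (Star)

-- A permutation of [n] (0-indexed as Fin n): an injective self-map of Fin n.
IsPerm : ∀ {n} → (Fin n → Fin n) → Set
IsPerm f = Injective _≡_ _≡_ f

-- Edge e ∈ S_{n+1} is directed from v to w (v, w ∈ S_n), i.e.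
-- ρ(e) = v and ρ'(e) = w, with ρ(e) = Order(e(1),…,e(n)) unfolded as the
-- unique σ with σ(c) < σ(d) iff e(c) < e(d), and similarly for ρ'.
DirectedFromTo : ∀ {n} → (Fin (suc n) → Fin (suc n)) → (Fin n → Fin n) → (Fin n → Fin n) → Set
DirectedFromTo {n} e v w =
  ∀ (c d : Fin n) →
    ((v c F.< v d → e (inject₁ c) F.< e (inject₁ d)) × (e (inject₁ c) F.< e (inject₁ d) → v c F.< v d))
  × ((w c F.< w d → e (fsuc c) F.< e (fsuc d)) × (e (fsuc c) F.< e (fsuc d) → w c F.< w d))

-- Raw data of a path of length ℓ in G_n: vertices v_0,…,v_ℓ (vert a, a ≤ ℓ)
-- and edges e_1,…,e_ℓ (edge a, 1 ≤ a ≤ ℓ).  Values at other indices are ignored.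
record RawPath (n : ℕ) : Set where
  field
    len  : ℕ
    vert : ℕ → Fin n → Fin n
    edge : ℕ → Fin (suc n) → Fin (suc n)
open RawPath public

IsPath : ∀ {n} → RawPath n → Set
IsPath p =
    (∀ a → a ≤ℕ len p → IsPerm (vert p a))
  × (∀ a → 1 ≤ℕ a → a ≤ℕ len p →
       IsPerm (edge p a) × DirectedFromTo (edge p a) (vert p (a ∸ 1)) (vert p a))

IsLoopAt : ∀ {n} → RawPath n → (Fin n → Fin n) → Set
IsLoopAt p v =
    IsPath p
  × 1 ≤ℕ len p
  × (∀ c → vert p 0 c ≡ v c)
  × (∀ c → vert p (len p) c ≡ v c)

concat : ∀ {n} → RawPath n → RawPath n → RawPath n
concat β γ = record
  { len  = len β + len γ
  ; vert = λ a → pick a (vert β a) (vert γ (a ∸ len β))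
  ; edge = λ a → pick a (edge β a) (edge γ (a ∸ len β))
  }
  where
    pick : ∀ {A : Set} → ℕ → A → A → A
    pick a x y with a ≤? len β
    ... | yes _ = x
    ... | no  _ = y

-- Generating relation of the poset Q_p on indices of x_1,…,x_{ℓ+n}
-- (x_k is represented by the natural number k, 1-indexed as in the paper).
QGen : ∀ {n} → RawPath n → ℕ → ℕ → Set
QGen {n} p x y =
    (Σ ℕ λ a → a ≤ℕ len p × Σ (Fin n) λ c → Σ (Fin n) λ d →
        x ≡ a + suc (toℕ c) × y ≡ a + suc (toℕ d) × vert p a c F.≤ vert p a d)
  ⊎ (Σ ℕ λ a → 1 ≤ℕ a × a ≤ℕ len p × Σ (Fin (suc n)) λ c → Σ (Fin (suc n)) λ d →
        x ≡ (a ∸ 1) + suc (toℕ c) × y ≡ (a ∸ 1) + suc (toℕ d) × edge p a c F.≤ edge p a d)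

_⊑[_]_ : ∀ {n} → ℕ → RawPath n → ℕ → Set
x ⊑[ p ] y = Star (QGen p) x y

DriftZero : ∀ {n} → RawPath n → Fin n → Fin n → Set
DriftZero p i j =
  ¬ (suc (toℕ i) ⊑[ p ] (len p + suc (toℕ j))) × ¬ ((len p + suc (toℕ j)) ⊑[ p ] suc (toℕ i))

TotallyDriftless : ∀ {n} → RawPath n → Set
TotallyDriftless {n} p = ∀ (i j : Fin n) → DriftZero p i j

-- The poset Q_{βγ} is Q_β and Q_γ glued along the n elements coming from the common
-- vertex v_{ℓ_β}: every generating relation lies entirely in the β-part (indices ≤ ℓ_β + n)
-- or entirely in the γ-part (indices > ℓ_β), where it is a generating relation of Q_γ
-- shifted by ℓ_β.  A chain in Q_{βγ} between x_{ℓ_β+ℓ_γ+j} and x_i must therefore enter the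
-- shared block at some x_{ℓ_β+c}, and the part of the chain before that is a chain in Q_γ
-- between x_{ℓ_γ+j} and x_c, which the driftlessness of γ forbids.
module Submission where

open import Defs
open import Data.Nat using (ℕ; suc; _+_; _∸_; _≤?_; _<_; z≤n; s≤s; z<s; s≤s⁻¹) renaming (_≤_ to _≤ℕ_)
open import Data.Nat.Properties
open import Data.Fin using (Fin; toℕ; fromℕ<)
import Data.Fin as F
open import Data.Fin.Properties using (toℕ<n; toℕ-fromℕ<)
open import Data.Product using (∃; _×_; _,_; proj₁; proj₂)
open import Data.Sum using (_⊎_; inj₁; inj₂)
import Data.Sum as Sum
open import Level using (Level)
open import Relation.Nullary using (yes; no; ¬_)
open import Relation.Unary using (Pred)
open import Relation.Binary using (Rel)
open import Relation.Binary.PropositionalEquality using (_≡_; refl; sym; trans; cong; subst; subst₂)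
open import Relation.Binary.Construct.Closure.ReflexiveTransitive using (Star; ε; _◅_; reverse)
open import Function using (id)

module _ {a b p q r s : Level} {A : Set a} {B : Set b} {S : Rel A r} {T : Rel B s}
         (P : Pred A p) (Q : Pred A q) (f : A → B) where

  star-exit : (∀ {x y} → S x y → P x → Q x ⊎ (P y × T (f x) (f y))) →
              ∀ {x z} → Star S x z → P x → Q z →
              ∃ λ w → P w × Q w × Star T (f x) (f w)
  star-exit step {x} ε        Px Qz = x , Px , Qz , ε
  star-exit step {x} (g ◅ gs) Px Qz with step g Px
  ... | inj₁ Qx        = x , Px , Qx , ε
  ... | inj₂ (Py , t) with star-exit step gs Py Qz
  ... | w , Pw , Qw , ts = w , Pw , Qw , t ◅ ts

shared-index : ∀ {n} L w → L < w → w ≤ℕ L + n → ∃ λ (c : Fin n) → w ∸ L ≡ suc (toℕ c)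
shared-index {n} L (suc w) (s≤s L≤w) w≤L+n = fromℕ< w∸L<n , trans w∸L-suc (cong suc (sym (toℕ-fromℕ< w∸L<n)))
  where
  w∸L-suc : suc w ∸ L ≡ suc (w ∸ L)
  w∸L-suc = +-∸-assoc 1 L≤w
  w∸L<n : w ∸ L < n
  w∸L<n = subst (_≤ℕ n) w∸L-suc (m≤n+o⇒m∸n≤o (suc w) L w≤L+n)

module _ {n : ℕ} (β γ : RawPath n) where

  private
    L = len β

  QGen-concat-split : ∀ {x y} → QGen (concat β γ) x y →
    (x ≤ℕ L + n × y ≤ℕ L + n) ⊎ (L < x × L < y × QGen γ (x ∸ L) (y ∸ L))
  QGen-concat-split (inj₁ (a , a≤ , c , d , refl , refl , c≤d)) with a ≤? L
  ... | yes a≤L = inj₁ (+-mono-≤ a≤L (toℕ<n c) , +-mono-≤ a≤L (toℕ<n d))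
  ... | no a≰L = inj₂ (L<a+ c , L<a+ d ,
          inj₁ (a ∸ L , m≤n+o⇒m∸n≤o a L a≤ , c , d , +-∸-comm _ (<⇒≤ L<a) , +-∸-comm _ (<⇒≤ L<a) , c≤d))
    where
    L<a = ≰⇒> a≰L
    L<a+ : ∀ c → L < a + suc (toℕ c)
    L<a+ c = <-≤-trans L<a (m≤m+n a _)
  QGen-concat-split (inj₂ (suc a , s≤s z≤n , a<≤ , c , d , refl , refl , c≤d)) with suc a ≤? L
  ... | yes a<L = inj₁ (a+≤ c , a+≤ d)
    where
    a+≤ : ∀ c → a + suc (toℕ c) ≤ℕ L + n
    a+≤ c = ≤-trans (≤-reflexive (+-suc a (toℕ c))) (+-mono-≤ a<L (s≤s⁻¹ (toℕ<n c)))
  -- The γ-edge index is taken as suc (a ∸ L) rather than suc a ∸ L so that QGen's ∸ 1 reduces.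
  ... | no a≮L = inj₂ (L<a+ c , L<a+ d ,
          inj₂ (suc (a ∸ L) , s≤s z≤n , subst (_≤ℕ len γ) sa∸L (m≤n+o⇒m∸n≤o (suc a) L a<≤) ,
                c , d , +-∸-comm _ L≤a , +-∸-comm _ L≤a ,
                subst (λ b → edge γ b c F.≤ edge γ b d) sa∸L c≤d))
    where
    L≤a = s≤s⁻¹ (≰⇒> a≮L)
    sa∸L : suc a ∸ L ≡ suc (a ∸ L)
    sa∸L = +-∸-assoc 1 L≤a
    L<a+ : ∀ c → L < a + suc (toℕ c)
    L<a+ c = ≤-<-trans L≤a (m<m+n a z<s)

  γ-step-forward : ∀ {x y} → QGen (concat β γ) x y → L < x →
                   x ≤ℕ L + n ⊎ (L < y × QGen γ (x ∸ L) (y ∸ L))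
  γ-step-forward g _ = Sum.map proj₁ proj₂ (QGen-concat-split g)

  γ-step-backward : ∀ {x y} → QGen (concat β γ) y x → L < x →
                    x ≤ℕ L + n ⊎ (L < y × QGen γ (y ∸ L) (x ∸ L))
  γ-step-backward g _ = Sum.map proj₂ (λ (L<y , _ , t) → L<y , t) (QGen-concat-split g)

  exit-γ-part : ∀ {r s} {S : Rel ℕ r} {T : Rel ℕ s} →
                (∀ {x y} → S x y → L < x → x ≤ℕ L + n ⊎ (L < y × T (x ∸ L) (y ∸ L))) →
                ∀ (j : Fin n) {z} → Star S (L + len γ + suc (toℕ j)) z → z ≤ℕ L + n →
                ∃ λ (c : Fin n) → Star T (len γ + suc (toℕ j)) (suc (toℕ c))
  exit-γ-part {T = T} step j chain z≤ with star-exit (L <_) (_≤ℕ L + n) (_∸ L) step chain L<end z≤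
    where
    L<end : L < L + len γ + suc (toℕ j)
    L<end = ≤-<-trans (m≤m+n L (len γ)) (m<m+n (L + len γ) z<s)
  ... | w , L<w , w≤ , seg with shared-index L w L<w w≤
  ... | c , w∸L≡c = c , subst₂ (Star T) end-shift w∸L≡c seg
    where
    end-shift : L + len γ + suc (toℕ j) ∸ L ≡ len γ + suc (toℕ j)
    end-shift = trans (cong (_∸ L) (+-assoc L (len γ) _)) (m+n∸m≡n L _)

lemma4p6 : ∀ {n : ℕ} (v : Fin n → Fin n) (β γ : RawPath n) →
    IsPerm v → IsLoopAt β v → IsLoopAt γ v →
    TotallyDriftless γ → TotallyDriftless (concat β γ)
lemma4p6 {n} v β γ _ _ _ driftless i j = ¬up , ¬down
  where
  start≤ : suc (toℕ i) ≤ℕ len β + n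
  start≤ = m≤n⇒m≤o+n (len β) (toℕ<n i)

  ¬up : ¬ (suc (toℕ i) ⊑[ concat β γ ] (len β + len γ + suc (toℕ j)))
  ¬up chain with exit-γ-part β γ (γ-step-backward β γ) j (reverse id chain) start≤
  ... | c , seg = proj₁ (driftless c j) (reverse id seg)

  ¬down : ¬ ((len β + len γ + suc (toℕ j)) ⊑[ concat β γ ] suc (toℕ i))
  ¬down chain with exit-γ-part β γ (γ-step-forward β γ) j chain start≤
  ... | c , seg = proj₂ (driftless c j) seg
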